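{- Let $A,B$ be $n\times m$ integral matrices, $C$ an invertible $m\times m$ integral matrix, and $D$ an $m\times m$ matrix having at most one nonzero entry in each row, that entry being equal to $1$ or $-1$. Then the matrix $$E=\begin{pmatrix}A&B\\ CD&C\end{pmatrix}$$ is a Farkas matrix if and only if $A-BD$ is a Farkas matrix.
   Context: An integral matrix is a Farkas matrix if its columns are Farkas-related. Vectors $v_1,\dots,v_m\in\mathbb{Z}^n$ are Farkas-related if: for arbitrary integers $a_1\le b_1,\dots,a_m\le b_m$, whenever a vector $w\in\sum_{i=1}^m\mathbb{Z}v_i$ can be written as $w=\sum x_iv_i$ with rational $a_i\le x_i\le b_i$, it can also be written as $w=\sum y_iv_i$ with integers $a_i\le y_i\le b_i$. -}

module Defs where

open import Data.Nat as ℕ using (ℕ; zero; suc)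
open import Data.Fin using (Fin; zero; suc; splitAt)
open import Data.Sum using (_⊎_; inj₁; inj₂)
open import Data.Product using (_×_; ∃)
open import Data.Integer as ℤ using (ℤ; 0ℤ; 1ℤ; -1ℤ)
open import Data.Rational as ℚ using (ℚ; 0ℚ)
open import Relation.Binary.PropositionalEquality using (_≡_; _≢_)
import Data.Fin
import Relation.Nullary

sumℤ : ∀ {k} → (Fin k → ℤ) → ℤ
sumℤ {zero}  f = 0ℤ
sumℤ {suc k} f = f zero ℤ.+ sumℤ (λ i → f (suc i))

sumℚ : ∀ {k} → (Fin k → ℚ) → ℚ
sumℚ {zero}  f = 0ℚ
sumℚ {suc k} f = f zero ℚ.+ sumℚ (λ i → f (suc i))

toℚ : ℤ → ℚ
toℚ z = z ℚ./ 1

Vecℤ : ℕ → Set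
Vecℤ n = Fin n → ℤ

Matrix : ℕ → ℕ → Set
Matrix n m = Fin n → Fin m → ℤ

intComb : ∀ {k n} → (Fin k → Vecℤ n) → (Fin k → ℤ) → Vecℤ n
intComb v y j = sumℤ (λ i → y i ℤ.* v i j)

ratComb : ∀ {k n} → (Fin k → Vecℤ n) → (Fin k → ℚ) → Fin n → ℚ
ratComb v x j = sumℚ (λ i → x i ℚ.* toℚ (v i j))

InLattice : ∀ {k n} → (Fin k → Vecℤ n) → Vecℤ n → Set
InLattice v w = ∃ λ z → ∀ j → w j ≡ intComb v z j

FarkasRelated : ∀ {k n} → (Fin k → Vecℤ n) → Set
FarkasRelated {k} {n} v =
  (a b : Fin k → ℤ) → (∀ i → a i ℤ.≤ b i) →
  (w : Vecℤ n) → InLattice v w →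
  (∃ λ (x : Fin k → ℚ) →
     (∀ i → (toℚ (a i) ℚ.≤ x i) × (x i ℚ.≤ toℚ (b i))) ×
     (∀ j → toℚ (w j) ≡ ratComb v x j)) →
  ∃ λ (y : Fin k → ℤ) →
     (∀ i → (a i ℤ.≤ y i) × (y i ℤ.≤ b i)) ×
     (∀ j → w j ≡ intComb v y j)

columns : ∀ {n m} → Matrix n m → Fin m → Vecℤ n
columns M j i = M i j

FarkasMatrix : ∀ {n m} → Matrix n m → Set
FarkasMatrix M = FarkasRelated (columns M)

_⊗_ : ∀ {n k m} → Matrix n k → Matrix k m → Matrix n m
(M ⊗ N) i j = sumℤ (λ l → M i l ℤ.* N l j)

_⊖_ : ∀ {n m} → Matrix n m → Matrix n m → Matrix n m
(M ⊖ N) i j = M i j ℤ.- N i j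

identity : ∀ {m} → Matrix m m
identity i j with i Data.Fin.≟ j
... | Relation.Nullary.yes _ = 1ℤ
... | Relation.Nullary.no  _ = 0ℤ

Invertible : ∀ {m} → Matrix m m → Set
Invertible {m} C = ∃ λ (C' : Matrix m m) →
  (∀ i j → (C ⊗ C') i j ≡ identity i j) × (∀ i j → (C' ⊗ C) i j ≡ identity i j)

SignedPartial : ∀ {m} → Matrix m m → Set
SignedPartial D =
  (∀ r j → (D r j ≡ 0ℤ) ⊎ (D r j ≡ 1ℤ) ⊎ (D r j ≡ -1ℤ)) ×
  (∀ r j k → D r j ≢ 0ℤ → D r k ≢ 0ℤ → j ≡ k)

block : ∀ {n m} → Matrix n m → Matrix n m → Matrix m m → Matrix m m →
        Matrix (n ℕ.+ m) (m ℕ.+ m)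
block {n} {m} A B C D i j with splitAt n i | splitAt m j
... | inj₁ r | inj₁ c = A r c
... | inj₁ r | inj₂ c = B r c
... | inj₂ r | inj₁ c = (C ⊗ D) r c
... | inj₂ r | inj₂ c = C r c

{-# OPTIONS --safe #-}
-- The Farkas property of a matrix E only depends on which rational vectors E identifies:
-- it says that if a rational x in an integral box has the same image as an integral z,
-- then so does some integral y in that box.  Write x = (x₁ , x₂) and M = A - B D.  As C
-- is invertible, the image of x under block A B C D determines and is determined by
-- (M x₁ , D x₁ + x₂).  A box for x₁ extends to a box for x by any integral box around
-- x₂ = - D x₁, so rounding for the block matrix gives rounding for M.  Conversely,
-- x₂ = s - D x₁ with s integral, and every row of D is zero or ± a unit vector, so the box
-- constraints on x₂ turn into integral bounds on single coordinates of x₁; rounding x₁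
-- in this smaller box to y₁ and putting y₂ = s - D y₁ rounds x.
module Submission where

open import Defs
open import Data.Nat as ℕ using (ℕ; zero; suc; z≤n; s≤s)
open import Data.Fin as Fin using (Fin; zero; suc; splitAt; join; _↑ˡ_; _↑ʳ_; punchIn)
open import Data.Fin.Properties
  using (punchInᵢ≢i; splitAt-↑ˡ; splitAt-↑ʳ; join-splitAt; all?; ¬∀⟶∃¬)
open import Data.Vec.Functional using (foldr; take; drop; _++_)
open import Data.Vec.Functional.Properties using (lookup-++ˡ; lookup-++ʳ)
open import Data.Sum using (_⊎_; inj₁; inj₂; [_,_]; [_,_]′)
open import Data.Product using (_×_; _,_; ∃; proj₁; proj₂)
open import Data.Integer as ℤ using (ℤ; 0ℤ; 1ℤ; -1ℤ; +_; -[1+_]; +≤+; -≤+)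
import Data.Integer.Properties as ℤP
open import Data.Rational as ℚ using (ℚ; mkℚ; 0ℚ)
import Data.Rational.Properties as ℚP
open import Data.Rational.Unnormalised as ℚᵘ using (ℚᵘ; mkℚᵘ; *≡*; *≤*)
import Data.Rational.Unnormalised.Properties as ℚᵘP
open import Data.Rational.Solver using (module +-*-Solver)
open import Algebra.Bundles using (CommutativeRing)
open import Algebra.Properties.Group ℚP.+-0-group using (⁻¹-involutive; ∙-cancelʳ)
open import Algebra.Properties.Semiring.Sum (CommutativeRing.semiring ℚP.+-*-commutativeRing)
  using (sum; sum-cong-≗; sum-replicate-zero; sum-remove; ∑-distrib-+; ∑-comm; *-distribˡ-sum; *-distribʳ-sum)
open import Function using (_∘_)
open import Function.Bundles using (_⇔_; mk⇔; module Equivalence)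
open import Function.Properties.Equivalence using () renaming (trans to ⇔-trans; sym to ⇔-sym)
open import Relation.Nullary using (yes; no; contradiction)
open import Relation.Binary.PropositionalEquality hiding ([_])
open Equivalence using (to; from)

-- toℚ z is definitionally ℚ.fromℚᵘ (ι z).
ι : ℤ → ℚᵘ
ι z = mkℚᵘ z 0

toℚᵘ-toℚ : ∀ z → ℚ.toℚᵘ (toℚ z) ℚᵘ.≃ ι z
toℚᵘ-toℚ z = ℚP.toℚᵘ-fromℚᵘ (ι z)

toℚ-via-ℚᵘ : ∀ {z q} → ι z ℚᵘ.≃ ℚ.toℚᵘ q → toℚ z ≡ q
toℚ-via-ℚᵘ {q = q} e = trans (ℚP.fromℚᵘ-cong e) (ℚP.fromℚᵘ-toℚᵘ q)

toℚ-homo-+ : ∀ i j → toℚ (i ℤ.+ j) ≡ toℚ i ℚ.+ toℚ j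
toℚ-homo-+ i j = toℚ-via-ℚᵘ (begin
  ι (i ℤ.+ j)                          ≈⟨ *≡* (cong (ℤ._* 1ℤ) (cong₂ ℤ._+_ (i≡i*1 i) (i≡i*1 j))) ⟩
  ι i ℚᵘ.+ ι j                         ≈⟨ ℚᵘP.+-cong (toℚᵘ-toℚ i) (toℚᵘ-toℚ j) ⟨
  ℚ.toℚᵘ (toℚ i) ℚᵘ.+ ℚ.toℚᵘ (toℚ j)   ≈⟨ ℚP.toℚᵘ-homo-+ (toℚ i) (toℚ j) ⟨
  ℚ.toℚᵘ (toℚ i ℚ.+ toℚ j)             ∎)
  where
  open ℚᵘP.≃-Reasoning
  i≡i*1 : ∀ i → i ≡ i ℤ.* 1ℤ
  i≡i*1 i = sym (ℤP.*-identityʳ i)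

toℚ-homo-* : ∀ i j → toℚ (i ℤ.* j) ≡ toℚ i ℚ.* toℚ j
toℚ-homo-* i j = toℚ-via-ℚᵘ (begin
  ι (i ℤ.* j)                          ≈⟨ *≡* refl ⟩
  ι i ℚᵘ.* ι j                         ≈⟨ ℚᵘP.*-cong (toℚᵘ-toℚ i) (toℚᵘ-toℚ j) ⟨
  ℚ.toℚᵘ (toℚ i) ℚᵘ.* ℚ.toℚᵘ (toℚ j)   ≈⟨ ℚP.toℚᵘ-homo-* (toℚ i) (toℚ j) ⟨
  ℚ.toℚᵘ (toℚ i ℚ.* toℚ j)             ∎)
  where open ℚᵘP.≃-Reasoning

toℚ-homo‿- : ∀ i → toℚ (ℤ.- i) ≡ ℚ.- toℚ i
toℚ-homo‿- i = toℚ-via-ℚᵘ (begin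
  ι (ℤ.- i)                ≈⟨ *≡* refl ⟩
  ℚᵘ.- ι i                 ≈⟨ ℚᵘP.-‿cong (toℚᵘ-toℚ i) ⟨
  ℚᵘ.- ℚ.toℚᵘ (toℚ i)      ≈⟨ ℚP.toℚᵘ-homo‿- (toℚ i) ⟨
  ℚ.toℚᵘ (ℚ.- toℚ i)       ∎)
  where open ℚᵘP.≃-Reasoning

toℚ-homo-sub : ∀ i j → toℚ (i ℤ.- j) ≡ toℚ i ℚ.- toℚ j
toℚ-homo-sub i j = trans (toℚ-homo-+ i (ℤ.- j)) (cong (toℚ i ℚ.+_) (toℚ-homo‿- j))

toℚ-mono-≤ : ∀ {i j} → i ℤ.≤ j → toℚ i ℚ.≤ toℚ j
toℚ-mono-≤ {i} {j} i≤j = ℚP.toℚᵘ-cancel-≤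
  (ℚᵘP.≤-respˡ-≃ (ℚᵘP.≃-sym (toℚᵘ-toℚ i)) (ℚᵘP.≤-respʳ-≃ (ℚᵘP.≃-sym (toℚᵘ-toℚ j))
    (*≤* (ℤP.*-monoʳ-≤-nonNeg 1ℤ i≤j))))

toℚ-cancel-≤ : ∀ {i j} → toℚ i ℚ.≤ toℚ j → i ℤ.≤ j
toℚ-cancel-≤ {i} {j} i≤j
  with ℚᵘP.≤-respˡ-≃ (toℚᵘ-toℚ i) (ℚᵘP.≤-respʳ-≃ (toℚᵘ-toℚ j) (ℚP.toℚᵘ-mono-≤ i≤j))
... | *≤* i*1≤j*1 = ℤP.*-cancelʳ-≤-pos i j 1ℤ i*1≤j*1

toℚ-injective : ∀ {i j} → toℚ i ≡ toℚ j → i ≡ j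
toℚ-injective i≡j =
  ℤP.≤-antisym (toℚ-cancel-≤ (ℚP.≤-reflexive i≡j)) (toℚ-cancel-≤ (ℚP.≤-reflexive (sym i≡j)))

boundedAbove : ∀ q → ∃ λ u → q ℚ.≤ toℚ u
boundedAbove (mkℚ (+ n) d _) = + n , ℚP.toℚᵘ-cancel-≤
  (ℚᵘP.≤-respʳ-≃ (ℚᵘP.≃-sym (toℚᵘ-toℚ (+ n))) (*≤* (ℤP.*-monoˡ-≤-nonNeg (+ n) (+≤+ (s≤s z≤n)))))
boundedAbove (mkℚ -[1+ n ] d _) = 0ℤ , ℚP.toℚᵘ-cancel-≤
  (ℚᵘP.≤-respʳ-≃ (ℚᵘP.≃-sym (toℚᵘ-toℚ 0ℤ)) (*≤* -≤+))

boundedBelow : ∀ q → ∃ λ l → toℚ l ℚ.≤ q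
boundedBelow q with boundedAbove (ℚ.- q)
... | u , -q≤u = ℤ.- u , subst₂ ℚ._≤_ (sym (toℚ-homo‿- u)) (⁻¹-involutive q) (ℚP.neg-antimono-≤ -q≤u)

open ≡-Reasoning

sum-zero : ∀ {k} {f : Fin k → ℚ} → (∀ j → f j ≡ 0ℚ) → sum f ≡ 0ℚ
sum-zero {k} f≡0 = trans (sum-cong-≗ f≡0) (sum-replicate-zero k)

sum-single : ∀ {k} (f : Fin k → ℚ) i → (∀ j → j ≢ i → f j ≡ 0ℚ) → sum f ≡ f i
sum-single {suc k} f i others = begin
  sum f                                  ≡⟨ sum-remove f ⟩
  f i ℚ.+ sum (λ j → f (punchIn i j))    ≡⟨ cong (f i ℚ.+_) (sum-zero (λ j → others _ (punchInᵢ≢i i j))) ⟩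
  f i ℚ.+ 0ℚ                             ≡⟨ ℚP.+-identityʳ (f i) ⟩
  f i                                    ∎

sum-split : ∀ m {n} (f : Fin (m ℕ.+ n) → ℚ) → sum f ≡ sum (take m f) ℚ.+ sum (drop m f)
sum-split zero    f = sym (ℚP.+-identityˡ (sum f))
sum-split (suc m) f =
  trans (cong (f zero ℚ.+_) (sum-split m (f ∘ suc))) (sym (ℚP.+-assoc (f zero) _ _))

sumℚ≡sum : ∀ {k} (f : Fin k → ℚ) → sumℚ f ≡ sum f
sumℚ≡sum {zero}  f = refl
sumℚ≡sum {suc k} f = cong (f zero ℚ.+_) (sumℚ≡sum (f ∘ suc))

infix  8 ↑_
infixr 7 _·_

↑_ : ∀ {k} → (Fin k → ℤ) → Fin k → ℚ
(↑ z) i = toℚ (z i)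

_·_ : ∀ {n k} → Matrix n k → (Fin k → ℚ) → Fin n → ℚ
(M · x) i = sum (λ j → x j ℚ.* toℚ (M i j))

toℚ-sumℤ : ∀ {k} (f : Fin k → ℤ) → toℚ (sumℤ f) ≡ sum (↑ f)
toℚ-sumℤ {zero}  f = refl
toℚ-sumℤ {suc k} f =
  trans (toℚ-homo-+ (f zero) _) (cong (toℚ (f zero) ℚ.+_) (toℚ-sumℤ (f ∘ suc)))

ratComb≡· : ∀ {n k} (M : Matrix n k) x → ratComb (columns M) x ≗ M · x
ratComb≡· M x i = sumℚ≡sum (λ j → x j ℚ.* toℚ (M i j))

toℚ-intComb : ∀ {n k} (M : Matrix n k) z → ↑ intComb (columns M) z ≗ M · ↑ z
toℚ-intComb M z i =
  trans (toℚ-sumℤ (λ j → z j ℤ.* M i j)) (sum-cong-≗ (λ j → toℚ-homo-* (z j) (M i j)))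

·-cong : ∀ {n k} (M : Matrix n k) {x y} → x ≗ y → M · x ≗ M · y
·-cong M x≗y i = sum-cong-≗ (λ j → cong (ℚ._* toℚ (M i j)) (x≗y j))

·-cong-row : ∀ {n n′ k} (M : Matrix n k) (N : Matrix n′ k) {i i′} →
             (∀ j → M i j ≡ N i′ j) → ∀ x → (M · x) i ≡ (N · x) i′
·-cong-row M N Mi≡Ni′ x = sum-cong-≗ (λ j → cong (λ e → x j ℚ.* toℚ e) (Mi≡Ni′ j))

·-+ : ∀ {n k} (M : Matrix n k) x y i →
      (M · (λ j → x j ℚ.+ y j)) i ≡ (M · x) i ℚ.+ (M · y) i
·-+ M x y i = trans (sum-cong-≗ (λ j → ℚP.*-distribʳ-+ (toℚ (M i j)) (x j) (y j)))
                    (∑-distrib-+ (λ j → x j ℚ.* toℚ (M i j)) (λ j → y j ℚ.* toℚ (M i j)))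

·-⊖ : ∀ {n k} (P Q : Matrix n k) x i → ((P ⊖ Q) · x) i ℚ.+ (Q · x) i ≡ (P · x) i
·-⊖ P Q x i = trans (sym (∑-distrib-+ (λ j → x j ℚ.* toℚ ((P ⊖ Q) i j)) (λ j → x j ℚ.* toℚ (Q i j))))
                    (sum-cong-≗ entry)
  where
  open +-*-Solver
  entry : ∀ j → x j ℚ.* toℚ (P i j ℤ.- Q i j) ℚ.+ x j ℚ.* toℚ (Q i j) ≡ x j ℚ.* toℚ (P i j)
  entry j rewrite toℚ-homo-sub (P i j) (Q i j) =
    solve 3 (λ x p q → x :* (p :- q) :+ x :* q := x :* p) refl (x j) (toℚ (P i j)) (toℚ (Q i j))

·-⊗ : ∀ {n k m} (P : Matrix n k) (Q : Matrix k m) x → (P ⊗ Q) · x ≗ P · (Q · x)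
·-⊗ P Q x i = begin
  sum (λ c → x c ℚ.* toℚ (sumℤ (λ l → P i l ℤ.* Q l c)))   ≡⟨ sum-cong-≗ (λ c → cong (x c ℚ.*_) (PQ c)) ⟩
  sum (λ c → x c ℚ.* sum (λ l → p l ℚ.* q l c))             ≡⟨ sum-cong-≗ (λ c → *-distribˡ-sum (x c) (pq c)) ⟩
  sum (λ c → sum (λ l → x c ℚ.* (p l ℚ.* q l c)))           ≡⟨ ∑-comm (λ c l → x c ℚ.* (p l ℚ.* q l c)) ⟩
  sum (λ l → sum (λ c → x c ℚ.* (p l ℚ.* q l c)))           ≡⟨ sum-cong-≗ (λ l → sum-cong-≗ (λ c → reassoc l c)) ⟩
  sum (λ l → sum (λ c → x c ℚ.* q l c ℚ.* p l))             ≡⟨ sum-cong-≗ (λ l → *-distribʳ-sum (p l) (xq l)) ⟨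
  sum (λ l → (Q · x) l ℚ.* p l)                             ∎
  where
  open +-*-Solver
  p : _ → ℚ
  p l = toℚ (P i l)
  q : _ → _ → ℚ
  q l c = toℚ (Q l c)
  pq : _ → _ → ℚ
  pq c l = p l ℚ.* q l c
  xq : _ → _ → ℚ
  xq l c = x c ℚ.* q l c
  PQ : ∀ c → toℚ (sumℤ (λ l → P i l ℤ.* Q l c)) ≡ sum (pq c)
  PQ c = toℚ-intComb (λ c l → Q l c) (P i) c
  reassoc : ∀ l c → x c ℚ.* (p l ℚ.* q l c) ≡ x c ℚ.* q l c ℚ.* p l
  reassoc l c = solve 3 (λ x p q → x :* (p :* q) := x :* q :* p) refl (x c) (p l) (q l c)

·-+-residual : ∀ {n k} (M : Matrix n k) y (s : Fin n → ℤ) i →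
               (M · ↑ y) i ℚ.+ toℚ (s i ℤ.- intComb (columns M) y i) ≡ toℚ (s i)
·-+-residual M y s i = begin
  My ℚ.+ toℚ (s i ℤ.- intComb (columns M) y i)        ≡⟨ cong (My ℚ.+_) (toℚ-homo-sub (s i) _) ⟩
  My ℚ.+ (toℚ (s i) ℚ.- toℚ (intComb (columns M) y i)) ≡⟨ cong (λ t → My ℚ.+ (toℚ (s i) ℚ.- t))
                                                              (toℚ-intComb M y i) ⟩
  My ℚ.+ (toℚ (s i) ℚ.- My)                            ≡⟨ solve 2 (λ d t → d :+ (t :- d) := t) refl My (toℚ (s i)) ⟩
  toℚ (s i)                                            ∎
  where
  open +-*-Solver
  My = (M · ↑ y) i

·-single : ∀ {n k} (M : Matrix n k) {i c} → (∀ j → j ≢ c → M i j ≡ 0ℤ) →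
           ∀ x → (M · x) i ≡ x c ℚ.* toℚ (M i c)
·-single M {i} {c} others x = sum-single (λ j → x j ℚ.* toℚ (M i j)) c
  (λ j j≢c → trans (cong (λ e → x j ℚ.* toℚ e) (others j j≢c)) (ℚP.*-zeroʳ (x j)))

·-zeroRow : ∀ {n k} (M : Matrix n k) {i} → (∀ j → M i j ≡ 0ℤ) → ∀ x → (M · x) i ≡ 0ℚ
·-zeroRow M zero-row x =
  sum-zero (λ j → trans (cong (λ e → x j ℚ.* toℚ e) (zero-row j)) (ℚP.*-zeroʳ (x j)))

·-split : ∀ {n} m {k} (M : Matrix n (m ℕ.+ k)) x i →
          (M · x) i ≡ ((λ r → take m (M r)) · take m x) i ℚ.+ ((λ r → drop m (M r)) · drop m x) i
·-split m M x i = sum-split m (λ j → x j ℚ.* toℚ (M i j))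

identity-diag : ∀ {k} (i : Fin k) → identity i i ≡ 1ℤ
identity-diag i with i Fin.≟ i
... | yes _   = refl
... | no  i≢i = contradiction refl i≢i

identity-offDiag : ∀ {k} {i j : Fin k} → j ≢ i → identity i j ≡ 0ℤ
identity-offDiag {i = i} {j} j≢i with i Fin.≟ j
... | yes i≡j = contradiction (sym i≡j) j≢i
... | no  _   = refl

·-identity : ∀ {k} x → identity {k} · x ≗ x
·-identity x i = trans (·-single identity (λ _ → identity-offDiag) x)
  (trans (cong (λ e → x i ℚ.* toℚ e) (identity-diag i)) (ℚP.*-identityʳ (x i)))

·-cancelˡ : ∀ {k} {C C′ : Matrix k k} → (∀ i j → (C′ ⊗ C) i j ≡ identity i j) →
            ∀ {u v} → C · u ≗ C · v → u ≗ v
·-cancelˡ {C = C} {C′} C′C≡I {u} {v} Cu≗Cv i = begin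
  u i                  ≡⟨ ·-identity u i ⟨
  (identity · u) i     ≡⟨ ·-cong-row identity (C′ ⊗ C) (λ j → sym (C′C≡I i j)) u ⟩
  ((C′ ⊗ C) · u) i     ≡⟨ ·-⊗ C′ C u i ⟩
  (C′ · (C · u)) i     ≡⟨ ·-cong C′ Cu≗Cv i ⟩
  (C′ · (C · v)) i     ≡⟨ ·-⊗ C′ C v i ⟨
  ((C′ ⊗ C) · v) i     ≡⟨ ·-cong-row (C′ ⊗ C) identity (C′C≡I i) v ⟩
  (identity · v) i     ≡⟨ ·-identity v i ⟩
  v i                  ∎

InBoxℚ : ∀ {k} → (a b : Fin k → ℤ) → (Fin k → ℚ) → Set
InBoxℚ a b x = ∀ i → (toℚ (a i) ℚ.≤ x i) × (x i ℚ.≤ toℚ (b i))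

InBoxℤ : ∀ {k} → (a b : Fin k → ℤ) → (Fin k → ℤ) → Set
InBoxℤ a b y = ∀ i → (a i ℤ.≤ y i) × (y i ℤ.≤ b i)

RoundsInBoxes : ∀ {n k} → Matrix n k → Set
RoundsInBoxes {k = k} E = ∀ (a b z : Fin k → ℤ) x → InBoxℚ a b x → E · x ≗ E · ↑ z →
  ∃ λ y → InBoxℤ a b y × E · ↑ y ≗ E · ↑ z

inBoxℚ⇒≤ : ∀ {k} {a b : Fin k → ℤ} {x} → InBoxℚ a b x → ∀ i → a i ℤ.≤ b i
inBoxℚ⇒≤ x∈box i = toℚ-cancel-≤ (ℚP.≤-trans (proj₁ (x∈box i)) (proj₂ (x∈box i)))

inBoxℤ⇒inBoxℚ : ∀ {k} {a b y : Fin k → ℤ} → InBoxℤ a b y → InBoxℚ a b (↑ y)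
inBoxℤ⇒inBoxℚ y∈box i = toℚ-mono-≤ (proj₁ (y∈box i)) , toℚ-mono-≤ (proj₂ (y∈box i))

inBoxℚ⇒inBoxℤ : ∀ {k} {a b y : Fin k → ℤ} → InBoxℚ a b (↑ y) → InBoxℤ a b y
inBoxℚ⇒inBoxℤ y∈box i = toℚ-cancel-≤ (proj₁ (y∈box i)) , toℚ-cancel-≤ (proj₂ (y∈box i))

integerBox : ∀ {k} (x : Fin k → ℚ) → ∃ λ a → ∃ λ b → InBoxℚ a b x
integerBox x = (λ i → proj₁ (boundedBelow (x i))) , (λ i → proj₁ (boundedAbove (x i))) ,
               λ i → proj₂ (boundedBelow (x i)) , proj₂ (boundedAbove (x i))

inBoxℚ-++ : ∀ {m n} {a b : Fin m → ℤ} {a′ b′ : Fin n → ℤ} {x x′} →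
            InBoxℚ a b x → InBoxℚ a′ b′ x′ → InBoxℚ (a ++ a′) (b ++ b′) (x ++ x′)
inBoxℚ-++ {m} x∈box x′∈box i with splitAt m i
... | inj₁ c = x∈box c
... | inj₂ l = x′∈box l

inBoxℤ-take : ∀ {m n} {a b : Fin m → ℤ} {a′ b′ : Fin n → ℤ} {y} →
              InBoxℤ (a ++ a′) (b ++ b′) y → InBoxℤ a b (take m y)
inBoxℤ-take {m} {n} {a} {b} {a′} {b′} {y} y∈box c =
  subst₂ (λ α β → (α ℤ.≤ y (c ↑ˡ n)) × (y (c ↑ˡ n) ℤ.≤ β))
         (lookup-++ˡ a a′ c) (lookup-++ˡ b b′ c) (y∈box (c ↑ˡ n))

splitIndex : ∀ {m n} {P : Fin (m ℕ.+ n) → Set} →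
             (∀ i → P (i ↑ˡ n)) → (∀ j → P (m ↑ʳ j)) → ∀ k → P k
splitIndex {m} {n} {P} left right k =
  subst P (join-splitAt m n k) ([_,_] {C = P ∘ join m n} left right (splitAt m k))

inBoxℤ-++ : ∀ {m n} {a b : Fin (m ℕ.+ n) → ℤ} {y y′} →
            InBoxℤ (take m a) (take m b) y → InBoxℤ (drop m a) (drop m b) y′ → InBoxℤ a b (y ++ y′)
inBoxℤ-++ {m} {n} {a} {b} {y} {y′} y∈box y′∈box = splitIndex
  (λ c → subst (λ t → (a (c ↑ˡ n) ℤ.≤ t) × (t ℤ.≤ b (c ↑ˡ n))) (sym (lookup-++ˡ y y′ c)) (y∈box c))
  (λ l → subst (λ t → (a (m ↑ʳ l) ℤ.≤ t) × (t ℤ.≤ b (m ↑ʳ l))) (sym (lookup-++ʳ y y′ l)) (y′∈box l))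

farkas⇔roundsInBoxes : ∀ {n k} (E : Matrix n k) → FarkasMatrix E ⇔ RoundsInBoxes E
farkas⇔roundsInBoxes E = mk⇔ rounds farkas
  where
  rounds : FarkasMatrix E → RoundsInBoxes E
  rounds farkasE a b z x x∈box Ex≗Ez
    with farkasE a b (inBoxℚ⇒≤ x∈box) (intComb (columns E) z) (z , λ _ → refl) (x , x∈box , Ez≡Ex)
    where
    Ez≡Ex : ∀ i → toℚ (intComb (columns E) z i) ≡ ratComb (columns E) x i
    Ez≡Ex i = trans (toℚ-intComb E z i) (trans (sym (Ex≗Ez i)) (sym (ratComb≡· E x i)))
  ... | y , y∈box , Ez≡Ey = y , y∈box , λ i →
    trans (sym (toℚ-intComb E y i)) (trans (cong toℚ (sym (Ez≡Ey i))) (toℚ-intComb E z i))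

  farkas : RoundsInBoxes E → FarkasMatrix E
  farkas roundsE a b _ w (z , w≡Ez) (x , x∈box , w≡Ex) with roundsE a b z x x∈box Ex≗Ez
    where
    Ex≗Ez : E · x ≗ E · ↑ z
    Ex≗Ez i = trans (sym (ratComb≡· E x i))
                    (trans (sym (w≡Ex i)) (trans (cong toℚ (w≡Ez i)) (toℚ-intComb E z i)))
  ... | y , y∈box , Ey≗Ez = y , y∈box , λ i → toℚ-injective (begin
    toℚ (w i)                        ≡⟨ cong toℚ (w≡Ez i) ⟩
    toℚ (intComb (columns E) z i)    ≡⟨ toℚ-intComb E z i ⟩
    (E · ↑ z) i                      ≡⟨ Ey≗Ez i ⟨
    (E · ↑ y) i                      ≡⟨ toℚ-intComb E y i ⟨
    toℚ (intComb (columns E) y i)    ∎)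

shear : ∀ {m} → Matrix m m → (Fin (m ℕ.+ m) → ℚ) → Fin m → ℚ
shear {m} D x l = (D · take m x) l ℚ.+ drop m x l

shear-↑ : ∀ {m} (D : Matrix m m) z l →
          shear D (↑ z) l ≡ toℚ (intComb (columns D) (take m z) l ℤ.+ drop m z l)
shear-↑ {m} D z l = sym (trans (toℚ-homo-+ (intComb (columns D) (take m z) l) (drop m z l))
                               (cong (ℚ._+ toℚ (drop m z l)) (toℚ-intComb D (take m z) l)))

-- ker E = { (u , - D u) | u ∈ ker M }, stated without subtraction.
record KernelGraph {p n m} (E : Matrix p (m ℕ.+ m)) (M : Matrix n m) (D : Matrix m m) : Set where
  field
    sameImage⇔ : ∀ x x′ → E · x ≗ E · x′ ⇔ (M · take m x ≗ M · take m x′ × shear D x ≗ shear D x′)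

module _ {n m} (A B : Matrix n m) (C D : Matrix m m) where

  private
    E : Matrix (n ℕ.+ m) (m ℕ.+ m)
    E = block A B C D

    M : Matrix n m
    M = A ⊖ (B ⊗ D)

    E₁ E₂ : Matrix (n ℕ.+ m) m
    E₁ i = take m (E i)
    E₂ i = drop m (E i)

  block-top : ∀ x r → (E · x) (r ↑ˡ m) ≡ (M · take m x) r ℚ.+ (B · shear D x) r
  block-top x r = begin
    (E · x) (r ↑ˡ m)                                   ≡⟨ ·-split m E x (r ↑ˡ m) ⟩
    (E₁ · x₁) (r ↑ˡ m) ℚ.+ (E₂ · x₂) (r ↑ˡ m)           ≡⟨ cong₂ ℚ._+_ (·-cong-row E₁ A A-entry x₁)
                                                                      (·-cong-row E₂ B B-entry x₂) ⟩
    (A · x₁) r ℚ.+ (B · x₂) r                           ≡⟨ cong (ℚ._+ (B · x₂) r) (·-⊖ A (B ⊗ D) x₁ r) ⟨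
    (M · x₁) r ℚ.+ ((B ⊗ D) · x₁) r ℚ.+ (B · x₂) r      ≡⟨ ℚP.+-assoc ((M · x₁) r) _ _ ⟩
    (M · x₁) r ℚ.+ (((B ⊗ D) · x₁) r ℚ.+ (B · x₂) r)    ≡⟨ cong (λ e → (M · x₁) r ℚ.+ (e ℚ.+ (B · x₂) r))
                                                                (·-⊗ B D x₁ r) ⟩
    (M · x₁) r ℚ.+ ((B · (D · x₁)) r ℚ.+ (B · x₂) r)    ≡⟨ cong ((M · x₁) r ℚ.+_) (·-+ B (D · x₁) x₂ r) ⟨
    (M · x₁) r ℚ.+ (B · shear D x) r                    ∎
    where
    x₁ = take m x
    x₂ = drop m x
    A-entry : ∀ c → E₁ (r ↑ˡ m) c ≡ A r c
    A-entry c rewrite splitAt-↑ˡ n r m | splitAt-↑ˡ m c m = refl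
    B-entry : ∀ c → E₂ (r ↑ˡ m) c ≡ B r c
    B-entry c rewrite splitAt-↑ˡ n r m | splitAt-↑ʳ m m c = refl

  block-bottom : ∀ x r → (E · x) (n ↑ʳ r) ≡ (C · shear D x) r
  block-bottom x r = begin
    (E · x) (n ↑ʳ r)                                   ≡⟨ ·-split m E x (n ↑ʳ r) ⟩
    (E₁ · x₁) (n ↑ʳ r) ℚ.+ (E₂ · x₂) (n ↑ʳ r)           ≡⟨ cong₂ ℚ._+_ (·-cong-row E₁ (C ⊗ D) CD-entry x₁)
                                                                      (·-cong-row E₂ C C-entry x₂) ⟩
    ((C ⊗ D) · x₁) r ℚ.+ (C · x₂) r                     ≡⟨ cong (ℚ._+ (C · x₂) r) (·-⊗ C D x₁ r) ⟩
    (C · (D · x₁)) r ℚ.+ (C · x₂) r                     ≡⟨ ·-+ C (D · x₁) x₂ r ⟨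
    (C · shear D x) r                                   ∎
    where
    x₁ = take m x
    x₂ = drop m x
    CD-entry : ∀ c → E₁ (n ↑ʳ r) c ≡ (C ⊗ D) r c
    CD-entry c rewrite splitAt-↑ʳ n m r | splitAt-↑ˡ m c m = refl
    C-entry : ∀ c → E₂ (n ↑ʳ r) c ≡ C r c
    C-entry c rewrite splitAt-↑ʳ n m r | splitAt-↑ʳ m m c = refl

  kernelGraph-block : ∀ {C′} → (∀ i j → (C′ ⊗ C) i j ≡ identity i j) → KernelGraph E M D
  kernelGraph-block {C′} C′C≡I = record { sameImage⇔ = λ x x′ → mk⇔ (split x x′) (unsplit x x′) }
    where
    Split : (x x′ : Fin (m ℕ.+ m) → ℚ) → Set
    Split x x′ = M · take m x ≗ M · take m x′ × shear D x ≗ shear D x′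

    split : ∀ x x′ → E · x ≗ E · x′ → Split x x′
    split x x′ Ex≗Ex′ = Mx₁≗Mx₁′ , shear≗
      where
      shear≗ : shear D x ≗ shear D x′
      shear≗ = ·-cancelˡ {C = C} {C′} C′C≡I
        (λ r → trans (sym (block-bottom x r)) (trans (Ex≗Ex′ (n ↑ʳ r)) (block-bottom x′ r)))
      Mx₁≗Mx₁′ : M · take m x ≗ M · take m x′
      Mx₁≗Mx₁′ r = ∙-cancelʳ ((B · shear D x) r) ((M · take m x) r) ((M · take m x′) r) (begin
        (M · take m x) r ℚ.+ (B · shear D x) r       ≡⟨ block-top x r ⟨
        (E · x) (r ↑ˡ m)                             ≡⟨ Ex≗Ex′ (r ↑ˡ m) ⟩
        (E · x′) (r ↑ˡ m)                            ≡⟨ block-top x′ r ⟩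
        (M · take m x′) r ℚ.+ (B · shear D x′) r     ≡⟨ cong ((M · take m x′) r ℚ.+_) (·-cong B shear≗ r) ⟨
        (M · take m x′) r ℚ.+ (B · shear D x) r      ∎)

    unsplit : ∀ x x′ → Split x x′ → E · x ≗ E · x′
    unsplit x x′ (Mx₁≗Mx₁′ , shear≗) = splitIndex
      (λ r → trans (block-top x r)
                   (trans (cong₂ ℚ._+_ (Mx₁≗Mx₁′ r) (·-cong B shear≗ r)) (sym (block-top x′ r))))
      (λ r → trans (block-bottom x r) (trans (·-cong C shear≗ r) (sym (block-bottom x′ r))))

maximum minimum : ∀ {k} → ℤ → (Fin k → ℤ) → ℤ
maximum d f = foldr ℤ._⊔_ d f
minimum d f = foldr ℤ._⊓_ d f

d≤maximum : ∀ {k} d (f : Fin k → ℤ) → d ℤ.≤ maximum d f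
d≤maximum {zero}  d f = ℤP.≤-refl
d≤maximum {suc k} d f = ℤP.≤-trans (d≤maximum d (f ∘ suc)) (ℤP.i≤j⊔i (f zero) _)

f≤maximum : ∀ {k} d (f : Fin k → ℤ) l → f l ℤ.≤ maximum d f
f≤maximum {suc k} d f zero    = ℤP.i≤i⊔j (f zero) _
f≤maximum {suc k} d f (suc l) = ℤP.≤-trans (f≤maximum d (f ∘ suc) l) (ℤP.i≤j⊔i (f zero) _)

maximum-all : ∀ (P : ℤ → Set) {k d} {f : Fin k → ℤ} → P d → (∀ l → P (f l)) → P (maximum d f)
maximum-all P {zero}          Pd Pf = Pd
maximum-all P {suc k} {d} {f} Pd Pf =
  [ (λ e → subst P (sym e) (Pf zero)) , (λ e → subst P (sym e) (maximum-all P Pd (Pf ∘ suc))) ]′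
  (ℤP.⊔-sel (f zero) (maximum d (f ∘ suc)))

minimum≤d : ∀ {k} d (f : Fin k → ℤ) → minimum d f ℤ.≤ d
minimum≤d {zero}  d f = ℤP.≤-refl
minimum≤d {suc k} d f = ℤP.≤-trans (ℤP.i⊓j≤j (f zero) _) (minimum≤d d (f ∘ suc))

minimum≤f : ∀ {k} d (f : Fin k → ℤ) l → minimum d f ℤ.≤ f l
minimum≤f {suc k} d f zero    = ℤP.i⊓j≤i (f zero) _
minimum≤f {suc k} d f (suc l) = ℤP.≤-trans (ℤP.i⊓j≤j (f zero) _) (minimum≤f d (f ∘ suc) l)

minimum-all : ∀ (P : ℤ → Set) {k d} {f : Fin k → ℤ} → P d → (∀ l → P (f l)) → P (minimum d f)
minimum-all P {zero}          Pd Pf = Pd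
minimum-all P {suc k} {d} {f} Pd Pf =
  [ (λ e → subst P (sym e) (Pf zero)) , (λ e → subst P (sym e) (minimum-all P Pd (Pf ∘ suc))) ]′
  (ℤP.⊓-sel (f zero) (minimum d (f ∘ suc)))

≤-byGap : ∀ {p q p′ q′ : ℚ} → q ℚ.- p ≡ q′ ℚ.- p′ → p ℚ.≤ q → p′ ℚ.≤ q′
≤-byGap {p} {q} {p′} {q′} gap p≤q = subst₂ ℚ._≤_ p+t≡p′ q+t≡q′ (ℚP.+-monoˡ-≤ (q′ ℚ.- q) p≤q)
  where
  open +-*-Solver
  p+t≡p′ : p ℚ.+ (q′ ℚ.- q) ≡ p′
  p+t≡p′ = begin
    p ℚ.+ (q′ ℚ.- q)     ≡⟨ solve 3 (λ p q q′ → p :+ (q′ :- q) := q′ :- (q :- p)) refl p q q′ ⟩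
    q′ ℚ.- (q ℚ.- p)     ≡⟨ cong (λ t → q′ ℚ.- t) gap ⟩
    q′ ℚ.- (q′ ℚ.- p′)   ≡⟨ solve 2 (λ q′ p′ → q′ :- (q′ :- p′) := p′) refl q′ p′ ⟩
    p′                   ∎
  q+t≡q′ : q ℚ.+ (q′ ℚ.- q) ≡ q′
  q+t≡q′ = solve 2 (λ q q′ → q :+ (q′ :- q) := q′) refl q q′

Unit : ℤ → Set
Unit σ = σ ≡ 1ℤ ⊎ σ ≡ -1ℤ

unit⇒nonzero : ∀ {σ} → Unit σ → σ ≢ 0ℤ
unit⇒nonzero (inj₁ refl) ()
unit⇒nonzero (inj₂ refl) ()

-- For a unit σ, [ lowerBound , upperBound ] is the set of u with α ≤ s - σ u ≤ β;
-- any other σ imposes no constraint beyond the default d.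
lowerBound upperBound : (σ d α β s : ℤ) → ℤ
lowerBound (+ 1)    d α β s = s ℤ.- β
lowerBound -[1+ 0 ] d α β s = α ℤ.- s
lowerBound _        d α β s = d
upperBound (+ 1)    d α β s = s ℤ.- α
upperBound -[1+ 0 ] d α β s = β ℤ.- s
upperBound _        d α β s = d

unitInterval : ∀ {σ d d′ α β s u v} → Unit σ → u ℚ.* toℚ σ ℚ.+ v ≡ toℚ s →
               (toℚ α ℚ.≤ v × v ℚ.≤ toℚ β) ⇔
               (toℚ (lowerBound σ d α β s) ℚ.≤ u × u ℚ.≤ toℚ (upperBound σ d′ α β s))
unitInterval {α = α} {β} {s} {u} {v} (inj₁ refl) σu+v≡s
  rewrite toℚ-homo-sub s β | toℚ-homo-sub s α | sym σu+v≡s =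
  mk⇔ (λ (α≤v , v≤β) → ≤-byGap gapβ v≤β , ≤-byGap gapα α≤v)
      (λ (l≤u , u≤h) → ≤-byGap (sym gapα) u≤h , ≤-byGap (sym gapβ) l≤u)
  where
  open +-*-Solver
  gapα : v ℚ.- toℚ α ≡ (u ℚ.* toℚ 1ℤ ℚ.+ v) ℚ.- toℚ α ℚ.- u
  gapα = solve 3 (λ u v a → v :- a := (u :* con (toℚ 1ℤ) :+ v) :- a :- u) refl u v (toℚ α)
  gapβ : toℚ β ℚ.- v ≡ u ℚ.- ((u ℚ.* toℚ 1ℤ ℚ.+ v) ℚ.- toℚ β)
  gapβ = solve 3 (λ u v b → b :- v := u :- ((u :* con (toℚ 1ℤ) :+ v) :- b)) refl u v (toℚ β)
unitInterval {α = α} {β} {s} {u} {v} (inj₂ refl) σu+v≡s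
  rewrite toℚ-homo-sub α s | toℚ-homo-sub β s | sym σu+v≡s =
  mk⇔ (λ (α≤v , v≤β) → ≤-byGap gapα α≤v , ≤-byGap gapβ v≤β)
      (λ (l≤u , u≤h) → ≤-byGap (sym gapα) l≤u , ≤-byGap (sym gapβ) u≤h)
  where
  open +-*-Solver
  gapα : v ℚ.- toℚ α ≡ u ℚ.- (toℚ α ℚ.- (u ℚ.* toℚ -1ℤ ℚ.+ v))
  gapα = solve 3 (λ u v a → v :- a := u :- (a :- (u :* con (toℚ -1ℤ) :+ v))) refl u v (toℚ α)
  gapβ : toℚ β ℚ.- v ≡ (toℚ β ℚ.- (u ℚ.* toℚ -1ℤ ℚ.+ v)) ℚ.- u
  gapβ = solve 3 (λ u v b → b :- v := (b :- (u :* con (toℚ -1ℤ) :+ v)) :- u) refl u v (toℚ β)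

ZeroRow : ∀ {m k} → Matrix m k → Fin m → Set
ZeroRow D l = ∀ c → D l c ≡ 0ℤ

zeroRow? : ∀ {m k} (D : Matrix m k) l → ZeroRow D l ⊎ ∃ λ c → D l c ≢ 0ℤ
zeroRow? {k = k} D l with all? (λ c → D l c ℤ.≟ 0ℤ)
... | yes zero-row = inj₁ zero-row
... | no  ¬zero    = inj₂ (¬∀⟶∃¬ k _ (λ c → D l c ℤ.≟ 0ℤ) ¬zero)

zeroRow-equation : ∀ {m k} (D : Matrix m k) {l} → ZeroRow D l →
                   ∀ u {v t} → (D · u) l ℚ.+ v ≡ t → v ≡ t
zeroRow-equation D zero-row u {v} Du+v≡t =
  trans (sym (ℚP.+-identityˡ v)) (trans (cong (ℚ._+ v) (sym (·-zeroRow D zero-row u))) Du+v≡t)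

signedPartial-unit : ∀ {m} {D : Matrix m m} → SignedPartial D → ∀ {l c} → D l c ≢ 0ℤ → Unit (D l c)
signedPartial-unit (entries , _) {l} {c} nonzero with entries l c
... | inj₁ D≡0  = contradiction D≡0 nonzero
... | inj₂ unit = unit

signedPartial-· : ∀ {m} {D : Matrix m m} → SignedPartial D →
                  ∀ {l c} → D l c ≢ 0ℤ → ∀ u → (D · u) l ≡ u c ℚ.* toℚ (D l c)
signedPartial-· {D = D} (_ , single) {l} {c} nonzero = ·-single D others
  where
  others : ∀ c′ → c′ ≢ c → D l c′ ≡ 0ℤ
  others c′ c′≢c with D l c′ ℤ.≟ 0ℤ
  ... | yes D≡0      = D≡0
  ... | no  nonzero′ = contradiction (single l c′ c nonzero′ nonzero) c′≢c

module Tightening {m} (D : Matrix m m) (a₁ b₁ a₂ b₂ s : Fin m → ℤ) where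

  rowLower rowUpper : Fin m → Fin m → ℤ
  rowLower c l = lowerBound (D l c) (a₁ c) (a₂ l) (b₂ l) (s l)
  rowUpper c l = upperBound (D l c) (b₁ c) (a₂ l) (b₂ l) (s l)

  tightLower tightUpper : Fin m → ℤ
  tightLower c = maximum (a₁ c) (rowLower c)
  tightUpper c = minimum (b₁ c) (rowUpper c)

  tighten : SignedPartial D → (∀ l → ZeroRow D l → (a₂ l ℤ.≤ s l) × (s l ℤ.≤ b₂ l)) →
            ∀ {u v} → (∀ l → (D · u) l ℚ.+ v l ≡ toℚ (s l)) →
            (InBoxℚ a₁ b₁ u × InBoxℚ a₂ b₂ v) ⇔ InBoxℚ tightLower tightUpper u
  tighten sp zeroRows {u} {v} Du+v≡s = mk⇔ restrict extend
    where
    rowEquation : ∀ {l c} → D l c ≢ 0ℤ → u c ℚ.* toℚ (D l c) ℚ.+ v l ≡ toℚ (s l)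
    rowEquation {l} nonzero = trans (cong (ℚ._+ v l) (sym (signedPartial-· sp nonzero u))) (Du+v≡s l)

    restrict : InBoxℚ a₁ b₁ u × InBoxℚ a₂ b₂ v → InBoxℚ tightLower tightUpper u
    restrict (u∈box , v∈box) c =
      maximum-all (λ t → toℚ t ℚ.≤ u c) (proj₁ (u∈box c)) (proj₁ ∘ rowBounds) ,
      minimum-all (λ t → u c ℚ.≤ toℚ t) (proj₂ (u∈box c)) (proj₂ ∘ rowBounds)
      where
      rowBounds : ∀ l → (toℚ (rowLower c l) ℚ.≤ u c) × (u c ℚ.≤ toℚ (rowUpper c l))
      rowBounds l with proj₁ sp l c
      ... | inj₁ D≡0 rewrite D≡0 = u∈box c
      ... | inj₂ unit = to (unitInterval unit (rowEquation (unit⇒nonzero unit))) (v∈box l)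

    extend : InBoxℚ tightLower tightUpper u → InBoxℚ a₁ b₁ u × InBoxℚ a₂ b₂ v
    extend u∈tight = u∈box , v∈box
      where
      u∈box : InBoxℚ a₁ b₁ u
      u∈box c = ℚP.≤-trans (toℚ-mono-≤ (d≤maximum (a₁ c) (rowLower c))) (proj₁ (u∈tight c)) ,
                ℚP.≤-trans (proj₂ (u∈tight c)) (toℚ-mono-≤ (minimum≤d (b₁ c) (rowUpper c)))

      v∈box : InBoxℚ a₂ b₂ v
      v∈box l with zeroRow? D l
      ... | inj₁ zero-row =
        subst (λ t → (toℚ (a₂ l) ℚ.≤ t) × (t ℚ.≤ toℚ (b₂ l)))
              (sym (zeroRow-equation D zero-row u (Du+v≡s l)))
              (toℚ-mono-≤ (proj₁ (zeroRows l zero-row)) , toℚ-mono-≤ (proj₂ (zeroRows l zero-row)))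
      ... | inj₂ (c , nonzero) =
        from (unitInterval (signedPartial-unit sp nonzero) (rowEquation nonzero))
             (ℚP.≤-trans (toℚ-mono-≤ (f≤maximum (a₁ c) (rowLower c) l)) (proj₁ (u∈tight c)) ,
              ℚP.≤-trans (proj₂ (u∈tight c)) (toℚ-mono-≤ (minimum≤f (b₁ c) (rowUpper c) l)))

module _ {p n m} {E : Matrix p (m ℕ.+ m)} {M : Matrix n m} {D : Matrix m m} (graph : KernelGraph E M D) where

  open KernelGraph graph

  -- Any integral box around x₂ = - D x will do, so D is arbitrary here.
  roundsInBoxes-reduce : RoundsInBoxes E → RoundsInBoxes M
  roundsInBoxes-reduce roundsE a b z x x∈box Mx≗Mz = take m Y , inBoxℤ-take Y∈box , My≗Mz
    where
    x₂ : Fin m → ℚ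
    x₂ l = ℚ.- (D · x) l
    z₂ : Fin m → ℤ
    z₂ l = ℤ.- intComb (columns D) z l
    a₂ = proj₁ (integerBox x₂)
    b₂ = proj₁ (proj₂ (integerBox x₂))

    take-Z : take m (↑ (z ++ z₂)) ≗ ↑ z
    take-Z c = cong toℚ (lookup-++ˡ z z₂ c)

    shear-X : ∀ l → shear D (x ++ x₂) l ≡ 0ℚ
    shear-X l = begin
      (D · take m (x ++ x₂)) l ℚ.+ (x ++ x₂) (m ↑ʳ l)   ≡⟨ cong₂ ℚ._+_ (·-cong D (lookup-++ˡ x x₂) l)
                                                                       (lookup-++ʳ x x₂ l) ⟩
      (D · x) l ℚ.- (D · x) l                           ≡⟨ ℚP.+-inverseʳ ((D · x) l) ⟩
      0ℚ                                                ∎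

    shear-Z : ∀ l → shear D (↑ (z ++ z₂)) l ≡ 0ℚ
    shear-Z l = begin
      (D · take m (↑ (z ++ z₂))) l ℚ.+ toℚ ((z ++ z₂) (m ↑ʳ l))   ≡⟨ cong₂ ℚ._+_ (·-cong D take-Z l)
                                                                                 (cong toℚ (lookup-++ʳ z z₂ l)) ⟩
      (D · ↑ z) l ℚ.+ toℚ (ℤ.- intComb (columns D) z l)           ≡⟨ cong ((D · ↑ z) l ℚ.+_)
                                                                         (toℚ-homo‿- (intComb (columns D) z l)) ⟩
      (D · ↑ z) l ℚ.- toℚ (intComb (columns D) z l)               ≡⟨ cong (λ t → (D · ↑ z) l ℚ.- t)
                                                                         (toℚ-intComb D z l) ⟩
      (D · ↑ z) l ℚ.- (D · ↑ z) l                                 ≡⟨ ℚP.+-inverseʳ ((D · ↑ z) l) ⟩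
      0ℚ                                                          ∎

    EX≗EZ : E · (x ++ x₂) ≗ E · ↑ (z ++ z₂)
    EX≗EZ = from (sameImage⇔ (x ++ x₂) (↑ (z ++ z₂)))
      ( (λ r → trans (·-cong M (lookup-++ˡ x x₂) r) (trans (Mx≗Mz r) (sym (·-cong M take-Z r))))
      , (λ l → trans (shear-X l) (sym (shear-Z l))) )

    X∈box : InBoxℚ (a ++ a₂) (b ++ b₂) (x ++ x₂)
    X∈box = inBoxℚ-++ x∈box (proj₂ (proj₂ (integerBox x₂)))

    rounded = roundsE (a ++ a₂) (b ++ b₂) (z ++ z₂) (x ++ x₂) X∈box EX≗EZ
    Y = proj₁ rounded
    Y∈box = proj₁ (proj₂ rounded)

    My≗Mz : M · ↑ (take m Y) ≗ M · ↑ z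
    My≗Mz r = trans (proj₁ (to (sameImage⇔ (↑ Y) (↑ (z ++ z₂))) (proj₂ (proj₂ rounded))) r)
                    (·-cong M take-Z r)

  roundsInBoxes-lift : SignedPartial D → RoundsInBoxes M → RoundsInBoxes E
  roundsInBoxes-lift sp roundsM a b z x x∈box Ex≗Ez = y₁ ++ y₂ , inBoxℤ-++ y₁∈box y₂∈box , Ey≗Ez
    where
    a₁ = take m a
    b₁ = take m b
    a₂ = drop m a
    b₂ = drop m b
    x₁ = take m x
    x₂ = drop m x

    s : Fin m → ℤ
    s l = intComb (columns D) (take m z) l ℤ.+ drop m z l

    x-split = to (sameImage⇔ x (↑ z)) Ex≗Ez

    Dx₁+x₂≡s : ∀ l → (D · x₁) l ℚ.+ x₂ l ≡ toℚ (s l)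
    Dx₁+x₂≡s l = trans (proj₂ x-split l) (shear-↑ D z l)

    zeroRows : ∀ l → ZeroRow D l → (a₂ l ℤ.≤ s l) × (s l ℤ.≤ b₂ l)
    zeroRows l zero-row = toℚ-cancel-≤ (subst (toℚ (a₂ l) ℚ.≤_) x₂≡s (proj₁ (x∈box (m ↑ʳ l)))) ,
                          toℚ-cancel-≤ (subst (ℚ._≤ toℚ (b₂ l)) x₂≡s (proj₂ (x∈box (m ↑ʳ l))))
      where
      x₂≡s : x₂ l ≡ toℚ (s l)
      x₂≡s = zeroRow-equation D zero-row x₁ (Dx₁+x₂≡s l)

    open Tightening D a₁ b₁ a₂ b₂ s

    x₁∈tight : InBoxℚ tightLower tightUpper x₁
    x₁∈tight = to (tighten sp zeroRows Dx₁+x₂≡s) (x∈box ∘ (_↑ˡ m) , x∈box ∘ (m ↑ʳ_))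

    rounded = roundsM tightLower tightUpper (take m z) x₁ x₁∈tight (proj₁ x-split)
    y₁ = proj₁ rounded

    y₂ : Fin m → ℤ
    y₂ l = s l ℤ.- intComb (columns D) y₁ l

    y∈box = from (tighten sp zeroRows (·-+-residual D y₁ s)) (inBoxℤ⇒inBoxℚ (proj₁ (proj₂ rounded)))
    y₁∈box = inBoxℚ⇒inBoxℤ (proj₁ y∈box)
    y₂∈box = inBoxℚ⇒inBoxℤ (proj₂ y∈box)

    take-y : take m (↑ (y₁ ++ y₂)) ≗ ↑ y₁
    take-y c = cong toℚ (lookup-++ˡ y₁ y₂ c)

    shear-y : shear D (↑ (y₁ ++ y₂)) ≗ shear D (↑ z)
    shear-y l = begin
      (D · take m (↑ (y₁ ++ y₂))) l ℚ.+ toℚ ((y₁ ++ y₂) (m ↑ʳ l))   ≡⟨ cong₂ ℚ._+_ (·-cong D take-y l)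
                                                                                   (cong toℚ (lookup-++ʳ y₁ y₂ l)) ⟩
      (D · ↑ y₁) l ℚ.+ toℚ (y₂ l)                                   ≡⟨ ·-+-residual D y₁ s l ⟩
      toℚ (s l)                                                     ≡⟨ shear-↑ D z l ⟨
      shear D (↑ z) l                                               ∎

    Ey≗Ez : E · ↑ (y₁ ++ y₂) ≗ E · ↑ z
    Ey≗Ez = from (sameImage⇔ (↑ (y₁ ++ y₂)) (↑ z))
      ((λ r → trans (·-cong M take-y r) (proj₂ (proj₂ rounded) r)) , shear-y)

proposition3p5 : (n m : ℕ) (A B : Matrix n m) (C D : Matrix m m) →
    Invertible C → SignedPartial D →
    FarkasMatrix (block A B C D) ⇔ FarkasMatrix (A ⊖ (B ⊗ D))
proposition3p5 n m A B C D (C′ , _ , C′C≡I) signedPartial =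
  ⇔-trans (farkas⇔roundsInBoxes (block A B C D))
  (⇔-trans (mk⇔ (roundsInBoxes-reduce graph) (roundsInBoxes-lift graph signedPartial))
           (⇔-sym (farkas⇔roundsInBoxes (A ⊖ (B ⊗ D)))))
  where
  graph = kernelGraph-block A B C D {C′} C′C≡I
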